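{- $\mathsf{H}$, with the unit and flattening described below, satisfies the axioms of a monad on the category of ranked sets: $\mathsf{H}$ is a functor; unit and flattening are natural transformations; $\mathrm{flatten}_\Sigma\circ\mathrm{flatten}_{\mathsf{H}\Sigma}=\mathrm{flatten}_\Sigma\circ\mathsf{H}\,\mathrm{flatten}_\Sigma$; and $\mathrm{flatten}_\Sigma\circ\mathrm{unit}_{\mathsf{H}\Sigma}=\mathrm{flatten}_\Sigma\circ\mathsf{H}\,\mathrm{unit}_\Sigma=\mathrm{id}_{\mathsf{H}\Sigma}$.
   Context: The category: ranked sets (sets whose elements have arities in $\{0,1,2,\dots\}$) with arity-preserving functions. A hypergraph over ranked set $\Sigma$: finite vertex set, finite ranked set of hyperedges, incidence function mapping each $n$-ary hyperedge $e$ to a non-repeating list $e[1],\dots,e[n]$ of vertices, arity-preserving labelling by $\Sigma$. An $n$-ary sourced hypergraph: hypergraph plus injective $\mathrm{source}:\{1..n\}\to$ vertices. $\mathsf{H}\Sigma$: the ranked set of finite sourced hypergraphs over $\Sigma$ modulo isomorphism (bijections on vertices and hyperedges respecting labels, incidence, sources). For arity-preserving $f$, $\mathsf{H}f$ applies $f$ to labels. $\mathrm{unit}_\Sigma(a)$ for $n$-ary $a$: vertices $\{1..n\}$, one $n$-ary hyperedge labelled $a$ with incidence list $(1,\dots,n)$, identity source function. $\mathrm{flatten}_\Sigma(G)$ for $G\in\mathsf{H}\mathsf{H}\Sigma$: hyperedges are pairs $(e,f)$, $e$ a hyperedge of $G$, $f$ a hyperedge in the label of $e$, with label and arity of $f$;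 vertices are vertices $v$ of $G$ and pairs $(e,v)$ with $v$ a non-source vertex in the label of $e$; source function inherited from $G$; the incidence list of $(e,f)$ is the incidence list of $f$ with the parent map applied: a vertex $v$ of the label of $e$ goes to $(e,v)$ if it is not a source there, and to $e[i]$ if it is the $i$-th source there. -}

module Defs where

open import Data.Nat using (ℕ; zero; suc; _+_)
open import Data.Fin using (Fin; zero; suc; _↑ˡ_; _↑ʳ_; splitAt; cast; _≟_)
open import Data.Fin.Properties using (splitAt-↑ˡ; splitAt-↑ʳ; any?)
open import Data.Bool using (if_then_else_)
open import Data.Product using (∃; _,_; proj₁; proj₂) renaming (Σ to Sigma)
open import Data.Sum using (_⊎_; inj₁; inj₂)
open import Relation.Nullary using (Dec; yes; no; does)
open import Relation.Binary.PropositionalEquality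
  using (_≡_; refl; sym; trans; cong; subst)
open import Function using (id; _∘_)
open import Function.Bundles using (_↔_; Inverse)
open import Function.Definitions using (Injective)

RankedSet : Set₁
RankedSet = ℕ → Set

_⇒_ : RankedSet → RankedSet → Set
A ⇒ B = ∀ {k} → A k → B k

record Hyp (Σ : RankedSet) (n : ℕ) : Set where
  field
    V       : ℕ
    E       : ℕ
    ar      : Fin E → ℕ
    inc     : (e : Fin E) → Fin (ar e) → Fin V
    inc-inj : (e : Fin E) → Injective _≡_ _≡_ (inc e)
    lab     : (e : Fin E) → Σ (ar e)
    src     : Fin n → Fin V
    src-inj : Injective _≡_ _≡_ src

open Hyp

H : RankedSet → RankedSet
H Σ = Hyp Σ

-- Isomorphism of sourced hypergraphs, where labels are compared by a
-- relation R (R = _≡_ for plain labels; R = isomorphism when the labels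
-- are themselves hypergraphs, i.e. elements of the quotient H Σ).

LabelRel : RankedSet → Set₁
LabelRel Σ = ∀ {k} → Σ k → Σ k → Set

record Iso {Σ : RankedSet} (R : LabelRel Σ) {n : ℕ} (G G' : Hyp Σ n) : Set where
  field
    vbij   : Fin (V G) ↔ Fin (V G')
    ebij   : Fin (E G) ↔ Fin (E G')
    ar≡    : ∀ e → ar G' (Inverse.to ebij e) ≡ ar G e
    inc≡   : ∀ e i → inc G' (Inverse.to ebij e) (cast (sym (ar≡ e)) i)
                     ≡ Inverse.to vbij (inc G e i)
    lab≈   : ∀ e → R (subst Σ (ar≡ e) (lab G' (Inverse.to ebij e))) (lab G e)
    src≡   : ∀ i → src G' i ≡ Inverse.to vbij (src G i)

-- Equality in H Σ, H H Σ, H H H Σ (isomorphism classes).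
_≈H_ : {Σ : RankedSet} → LabelRel (H Σ)
_≈H_ = Iso _≡_

_≈HH_ : {Σ : RankedSet} → LabelRel (H (H Σ))
_≈HH_ = Iso _≈H_

_≈HHH_ : {Σ : RankedSet} → LabelRel (H (H (H Σ)))
_≈HHH_ = Iso _≈HH_

mapH : {Σ Γ : RankedSet} → (Σ ⇒ Γ) → (H Σ ⇒ H Γ)
mapH f G = record
  { V = V G ; E = E G ; ar = ar G ; inc = inc G ; inc-inj = inc-inj G
  ; lab = λ e → f (lab G e) ; src = src G ; src-inj = src-inj G }

unit : {Σ : RankedSet} → (Σ ⇒ H Σ)
unit {Σ} {n} a = record
  { V = n ; E = 1 ; ar = λ _ → n ; inc = λ _ i → i ; inc-inj = λ _ p → p
  ; lab = λ _ → a ; src = id ; src-inj = λ p → p }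

sumF : (E : ℕ) → (Fin E → ℕ) → ℕ
sumF zero    k = 0
sumF (suc E) k = k zero + sumF E (λ e → k (suc e))

toΣ : ∀ E (k : Fin E → ℕ) → Fin (sumF E k) → Sigma (Fin E) (λ e → Fin (k e))
toΣ (suc E) k x with splitAt (k zero) x
... | inj₁ i = zero , i
... | inj₂ j with toΣ E (λ e → k (suc e)) j
...   | e , f = suc e , f

fromΣ : ∀ E (k : Fin E → ℕ) → Sigma (Fin E) (λ e → Fin (k e)) → Fin (sumF E k)
fromΣ (suc E) k (zero  , i) = i ↑ˡ sumF E (λ e → k (suc e))
fromΣ (suc E) k (suc e , f) = k zero ↑ʳ fromΣ E (λ e → k (suc e)) (e , f)

toΣ-fromΣ : ∀ E k p → toΣ E k (fromΣ E k p) ≡ p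
toΣ-fromΣ (suc E) k (zero , i) rewrite splitAt-↑ˡ (k zero) i (sumF E (λ e → k (suc e))) = refl
toΣ-fromΣ (suc E) k (suc e , f)
  rewrite splitAt-↑ʳ (k zero) (sumF E (λ e → k (suc e))) (fromΣ E (λ e → k (suc e)) (e , f))
        | toΣ-fromΣ E (λ e → k (suc e)) (e , f) = refl

fromΣ-inj : ∀ E k {p q} → fromΣ E k p ≡ fromΣ E k q → p ≡ q
fromΣ-inj E k {p} {q} h =
  trans (sym (toΣ-fromΣ E k p)) (trans (cong (toΣ E k) h) (toΣ-fromΣ E k q))

module Flatten {Σ : RankedSet} {n : ℕ} (G : Hyp (H Σ) n) where

  isSrc? : ∀ {m} (L : Hyp Σ m) (v : Fin (V L)) → Dec (∃ λ i → src L i ≡ v)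
  isSrc? L v = any? (λ i → src L i ≟ v)

  nsK : ∀ {m} (L : Hyp Σ m) → Fin (V L) → ℕ
  nsK L v = if does (isSrc? L v) then 0 else 1

  -- inner (non-source) vertices: pairs (e , v) with v a non-source
  -- vertex of the label of e
  NS : Set
  NS = Sigma (Fin (E G)) (λ e → Sigma (Fin (V (lab G e))) (λ v → Fin (nsK (lab G e) v)))

  innerCount : Fin (E G) → ℕ
  innerCount e = sumF (V (lab G e)) (nsK (lab G e))

  V' : ℕ
  V' = V G + sumF (E G) innerCount

  encV : Fin (V G) ⊎ NS → Fin V'
  encV (inj₁ v)           = v ↑ˡ sumF (E G) innerCount
  encV (inj₂ (e , v , z)) =
    V G ↑ʳ fromΣ (E G) innerCount (e , fromΣ (V (lab G e)) (nsK (lab G e)) (v , z))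

  encV-inj : ∀ {a b} → encV a ≡ encV b → a ≡ b
  encV-inj {inj₁ a} {inj₁ b} h
    with trans (sym (splitAt-↑ˡ (V G) a _)) (trans (cong (splitAt (V G)) h) (splitAt-↑ˡ (V G) b _))
  ... | refl = refl
  encV-inj {inj₁ a} {inj₂ (e , v , z)} h
    with trans (sym (splitAt-↑ˡ (V G) a _)) (trans (cong (splitAt (V G)) h) (splitAt-↑ʳ (V G) _ _))
  ... | ()
  encV-inj {inj₂ (e , v , z)} {inj₁ b} h
    with trans (sym (splitAt-↑ʳ (V G) _ _)) (trans (cong (splitAt (V G)) h) (splitAt-↑ˡ (V G) b _))
  ... | ()
  encV-inj {inj₂ (e , v , z)} {inj₂ (e' , v' , z')} h
    with trans (sym (splitAt-↑ʳ (V G) _ _)) (trans (cong (splitAt (V G)) h) (splitAt-↑ʳ (V G) _ _))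
  ... | h1 with fromΣ-inj (E G) innerCount (inj₂-inj h1)
    where inj₂-inj : ∀ {A B : Set} {x y : B} → inj₂ {A = A} x ≡ inj₂ y → x ≡ y
          inj₂-inj refl = refl
  ... | h2 with cong proj₁ h2
  ... | refl with fromΣ-inj (V (lab G e)) (nsK (lab G e)) {v , z} {v' , z'} (Σ-inj₂ h2)
    where Σ-inj₂ : ∀ {A : Set} {B : A → Set} {a} {x y : B a} →
                   _≡_ {A = Sigma A B} (a , x) (a , y) → x ≡ y
          Σ-inj₂ refl = refl
  ... | refl = refl

  -- the parent map from vertices of the label of e to vertices of the
  -- flattening: the i-th source goes to e[i], a non-source v to (e , v)
  parentAux : (e : Fin (E G)) (v : Fin (V (lab G e)))
              (d : Dec (∃ λ i → src (lab G e) i ≡ v)) →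
              isSrc? (lab G e) v ≡ d → Fin (V G) ⊎ NS
  parentAux e v (yes (i , _)) _  = inj₁ (inc G e i)
  parentAux e v (no _)        eq =
    inj₂ (e , v , subst (λ d → Fin (if does d then 0 else 1)) (sym eq) zero)

  parent : (e : Fin (E G)) → Fin (V (lab G e)) → Fin (V G) ⊎ NS
  parent e v = parentAux e v (isSrc? (lab G e) v) refl

  parentAux-inj : ∀ e v1 v2 d1 d2 eq1 eq2 →
                  parentAux e v1 d1 eq1 ≡ parentAux e v2 d2 eq2 → v1 ≡ v2
  parentAux-inj e v1 v2 (yes (i1 , p1)) (yes (i2 , p2)) eq1 eq2 h
    with inc-inj G e (inj₁-inj h)
    where inj₁-inj : ∀ {A B : Set} {x y : A} → inj₁ {B = B} x ≡ inj₁ y → x ≡ y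
          inj₁-inj refl = refl
  ... | refl = trans (sym p1) p2
  parentAux-inj e v1 v2 (yes _) (no _) eq1 eq2 ()
  parentAux-inj e v1 v2 (no _) (yes _) eq1 eq2 ()
  parentAux-inj e v1 v2 (no _) (no _) eq1 eq2 h = cong proj₁ (Σ-inj₂ (inj₂-inj h))
    where inj₂-inj : ∀ {A B : Set} {x y : B} → inj₂ {A = A} x ≡ inj₂ y → x ≡ y
          inj₂-inj refl = refl
          Σ-inj₂ : ∀ {A : Set} {B : A → Set} {a} {x y : B a} →
                   _≡_ {A = Sigma A B} (a , x) (a , y) → x ≡ y
          Σ-inj₂ refl = refl

  parent-inj : ∀ e → Injective _≡_ _≡_ (parent e)
  parent-inj e {v1} {v2} =
    parentAux-inj e v1 v2 (isSrc? (lab G e) v1) (isSrc? (lab G e) v2) refl refl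

  -- hyperedges: pairs (e , f) with f a hyperedge of the label of e
  E' : ℕ
  E' = sumF (E G) (λ e → E (lab G e))

  dec : Fin E' → Sigma (Fin (E G)) (λ e → Fin (E (lab G e)))
  dec = toΣ (E G) (λ e → E (lab G e))

  ar' : Fin E' → ℕ
  ar' x = ar (lab G (proj₁ (dec x))) (proj₂ (dec x))

  inc' : (x : Fin E') → Fin (ar' x) → Fin V'
  inc' x j = encV (parent (proj₁ (dec x))
                          (inc (lab G (proj₁ (dec x))) (proj₂ (dec x)) j))

  inc'-inj : ∀ x → Injective _≡_ _≡_ (inc' x)
  inc'-inj x h =
    inc-inj (lab G (proj₁ (dec x))) (proj₂ (dec x))
      (parent-inj (proj₁ (dec x)) (encV-inj h))

  result : Hyp Σ n
  result = record
    { V = V' ; E = E' ; ar = ar' ; inc = inc' ; inc-inj = inc'-inj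
    ; lab = λ x → lab (lab G (proj₁ (dec x))) (proj₂ (dec x))
    ; src = λ i → encV (inj₁ (src G i))
    ; src-inj = λ h → src-inj G (inj₁-inj (encV-inj h)) }
    where inj₁-inj : ∀ {A B : Set} {x y : A} → inj₁ {B = B} x ≡ inj₁ y → x ≡ y
          inj₁-inj refl = refl

flatten : {Σ : RankedSet} → (H (H Σ) ⇒ H Σ)
flatten G = Flatten.result G

-- Since quotients are not available, every operation is given on
-- representatives and the statement includes that each operation used
-- below respects isomorphism (i.e. is well defined on the quotient);
-- all equations are up to isomorphism.

record MonadLaws : Set₁ where
  field
    H-cong        : ∀ {Σ Γ : RankedSet} (f : Σ ⇒ Γ) {n} {G G' : H Σ n} →
                    G ≈H G' → mapH f G ≈H mapH f G'
    HH-cong       : ∀ {Σ Γ : RankedSet} (f : Σ ⇒ Γ) {n} {G G' : H (H Σ) n} →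
                    G ≈HH G' → mapH (mapH f) G ≈HH mapH (mapH f) G'
    unitH-cong    : ∀ {Σ : RankedSet} {n} {G G' : H Σ n} →
                    G ≈H G' → unit {H Σ} G ≈HH unit {H Σ} G'
    Hunit-cong    : ∀ {Σ : RankedSet} {n} {G G' : H Σ n} →
                    G ≈H G' → mapH (unit {Σ}) G ≈HH mapH (unit {Σ}) G'
    flatten-cong  : ∀ {Σ : RankedSet} {n} {G G' : H (H Σ) n} →
                    G ≈HH G' → flatten {Σ} G ≈H flatten {Σ} G'
    flattenH-cong : ∀ {Σ : RankedSet} {n} {G G' : H (H (H Σ)) n} →
                    G ≈HHH G' → flatten {H Σ} G ≈HH flatten {H Σ} G'
    Hflatten-cong : ∀ {Σ : RankedSet} {n} {G G' : H (H (H Σ)) n} →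
                    G ≈HHH G' → mapH (flatten {Σ}) G ≈HH mapH (flatten {Σ}) G'
    H-id          : ∀ {Σ : RankedSet} {n} (G : H Σ n) →
                    mapH {Σ} (λ {k} a → a) G ≈H G
    H-∘           : ∀ {Σ Γ Δ : RankedSet} (f : Σ ⇒ Γ) (g : Γ ⇒ Δ) {n} (G : H Σ n) →
                    mapH (λ {k} a → g (f a)) G ≈H mapH g (mapH f G)
    unit-nat      : ∀ {Σ Γ : RankedSet} (f : Σ ⇒ Γ) {n} (a : Σ n) →
                    unit {Γ} {n} (f {n} a) ≈H mapH f {n} (unit {Σ} {n} a)
    flatten-nat   : ∀ {Σ Γ : RankedSet} (f : Σ ⇒ Γ) {n} (G : H (H Σ) n) →
                    flatten (mapH (mapH f) G) ≈H mapH f (flatten G)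
    assoc         : ∀ {Σ : RankedSet} {n} (G : H (H (H Σ)) n) →
                    flatten {Σ} (flatten {H Σ} G) ≈H flatten {Σ} (mapH (flatten {Σ}) G)
    unit-left     : ∀ {Σ : RankedSet} {n} (G : H Σ n) →
                    flatten {Σ} (unit {H Σ} G) ≈H G
    unit-right    : ∀ {Σ : RankedSet} {n} (G : H Σ n) →
                    flatten {Σ} (mapH (unit {Σ}) G) ≈H G

-- Isomorphism classes are handled through presentations: hypergraphs whose vertices and edges
-- form arbitrary types. The flattening of G is isomorphic to the presentation with vertices
-- Fin (V G) ⊎ (inner vertices of the labels) and edges the pairs (e , f), and each monad law
-- becomes an explicit isomorphism of such presentations. For associativity both sides are
-- isomorphic to the flattening of two levels at once; the key fact is that flatten D has the
-- same sources as D, so its inner vertices are those of D plus those created by flattening D.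
module Submission where

open import Defs
open import Data.Nat using (ℕ; zero; suc)
open import Data.Bool using (if_then_else_)
open import Data.Fin using (Fin; zero; suc; cast; _↑ʳ_; splitAt; _≟_)
open import Data.Fin.Properties using (cast-is-id; cast-trans; +↔⊎; join-splitAt; any?)
open import Data.Product using (∃; _,_; proj₁; proj₂) renaming (Σ to Sigma)
open import Data.Product.Algebra using (Σ-assoc-alt)
open import Data.Product.Function.Dependent.Propositional using (Σ-↔)
open import Data.Sum using (_⊎_; inj₁; inj₂; [_,_]′)
open import Data.Sum.Properties using (inj₁-injective)
open import Data.Sum.Function.Propositional using (_⊎-↔_)
open import Data.Empty using (⊥; ⊥-elim)
open import Function using (id; _∘_)
open import Relation.Nullary using (Dec; yes; no; does; ¬_)
open import Relation.Binary.PropositionalEquality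
open import Function.Bundles using (_↔_; Inverse; Injection; mk↔ₛ′)
open import Function.Properties.Inverse using (↔-refl; ↔-sym; ↔-trans; ↔⇒↣)
open import Relation.Nullary.Decidable using (does-≡; map′)

open Hyp
open Inverse using (to; from; strictlyInverseˡ; strictlyInverseʳ)

private variable
  Σ Γ : RankedSet
  n : ℕ

record Presentation (Σ : RankedSet) (n : ℕ) : Set₁ where
  field
    Vertex    : Set
    Edge      : Set
    arity     : Edge → ℕ
    incidence : (e : Edge) → Fin (arity e) → Vertex
    label     : (e : Edge) → Σ (arity e)
    source    : Fin n → Vertex
open Presentation

record PresIso (R : LabelRel Σ) (A B : Presentation Σ n) : Set where
  field
    vertex↔    : Vertex A ↔ Vertex B
    edge↔      : Edge A ↔ Edge B
    arity≡     : ∀ e → arity B (to edge↔ e) ≡ arity A e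
    incidence≡ : ∀ e i → incidence B (to edge↔ e) (cast (sym (arity≡ e)) i)
                         ≡ to vertex↔ (incidence A e i)
    label≈     : ∀ e → R (subst Σ (arity≡ e) (label B (to edge↔ e))) (label A e)
    source≡    : ∀ i → source B i ≡ to vertex↔ (source A i)

present : Hyp Σ n → Presentation Σ n
present G = record
  { Vertex = Fin (V G) ; Edge = Fin (E G) ; arity = ar G
  ; incidence = inc G ; label = lab G ; source = src G }

Iso⇒PresIso : {R : LabelRel Σ} {G G' : Hyp Σ n} → Iso R G G' → PresIso R (present G) (present G')
Iso⇒PresIso I = record
  { vertex↔ = vbij ; edge↔ = ebij ; arity≡ = ar≡ ; incidence≡ = inc≡ ; label≈ = lab≈ ; source≡ = src≡ }
  where open Iso I

PresIso⇒Iso : {R : LabelRel Σ} {G G' : Hyp Σ n} → PresIso R (present G) (present G') → Iso R G G'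
PresIso⇒Iso I = record
  { vbij = vertex↔ ; ebij = edge↔ ; ar≡ = arity≡ ; inc≡ = incidence≡ ; lab≈ = label≈ ; src≡ = source≡ }
  where open PresIso I

dcong-cast : {S C : Set} (a : S → ℕ) (h : ∀ s → Fin (a s) → C) {s s' : S} → s ≡ s' →
             .(q : a s' ≡ a s) (i : Fin (a s')) → h s (cast q i) ≡ h s' i
dcong-cast a h refl q i = cong (h _) (cast-is-id q i)

dcong-subst : {S : Set} (a : S → ℕ) (l : ∀ s → Σ (a s)) {s s' : S} → s ≡ s' →
              (q : a s ≡ a s') → subst Σ q (l s) ≡ l s'
dcong-subst a l refl refl = refl

subst-preserves : (R : LabelRel Σ) {k k' : ℕ} (q : k ≡ k') {x y : Σ k} →
                  R x y → R (subst Σ q x) (subst Σ q y)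
subst-preserves R refl r = r

module _ {R : LabelRel Σ} where

  PresIso-refl : (∀ {k} {x : Σ k} → R x x) → (A : Presentation Σ n) → PresIso R A A
  PresIso-refl R-refl A = record
    { vertex↔ = ↔-refl ; edge↔ = ↔-refl ; arity≡ = λ _ → refl
    ; incidence≡ = λ e i → cong (incidence A e) (cast-is-id _ i)
    ; label≈ = λ _ → R-refl ; source≡ = λ _ → refl }

  PresIso-sym : (∀ {k} {x y : Σ k} → R x y → R y x) →
                {A B : Presentation Σ n} → PresIso R A B → PresIso R B A
  PresIso-sym R-sym {A = A} {B} I = record
    { vertex↔ = ↔-sym vertex↔ ; edge↔ = ↔-sym edge↔ ; arity≡ = arity≡′
    ; incidence≡ = incidence≡′ ; label≈ = label≈′ ; source≡ = source≡′ }
    where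
    open PresIso I
    open ≡-Reasoning

    arity≡′ : ∀ e → arity A (from edge↔ e) ≡ arity B e
    arity≡′ e = trans (sym (arity≡ (from edge↔ e))) (cong (arity B) (strictlyInverseˡ edge↔ e))

    incidence≡′ : ∀ e i → incidence A (from edge↔ e) (cast (sym (arity≡′ e)) i)
                          ≡ from vertex↔ (incidence B e i)
    incidence≡′ e i = begin
      incidence A e′ j
        ≡˘⟨ strictlyInverseʳ vertex↔ _ ⟩
      from vertex↔ (to vertex↔ (incidence A e′ j))
        ≡˘⟨ cong (from vertex↔) (incidence≡ e′ j) ⟩
      from vertex↔ (incidence B (to edge↔ e′) (cast (sym (arity≡ e′)) j))
        ≡⟨ cong (from vertex↔ ∘ incidence B (to edge↔ e′)) (cast-trans (sym (arity≡′ e)) (sym (arity≡ e′)) i) ⟩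
      from vertex↔ (incidence B (to edge↔ e′) (cast q i))
        ≡⟨ cong (from vertex↔) (dcong-cast (arity B) (incidence B) (strictlyInverseˡ edge↔ e) q i) ⟩
      from vertex↔ (incidence B e i)
        ∎
      where
      e′ : Edge A
      e′ = from edge↔ e
      j : Fin (arity A e′)
      j = cast (sym (arity≡′ e)) i
      q : arity B e ≡ arity B (to edge↔ e′)
      q = sym (cong (arity B) (strictlyInverseˡ edge↔ e))

    label≈′ : ∀ e → R (subst Σ (arity≡′ e) (label A (from edge↔ e))) (label B e)
    label≈′ e = subst (R (subst Σ (arity≡′ e) (label A e′)))
      (trans (subst-subst {P = Σ} (arity≡ e′))
             (dcong-subst (arity B) (label B) (strictlyInverseˡ edge↔ e) (trans (arity≡ e′) (arity≡′ e))))
      (subst-preserves R (arity≡′ e) (R-sym (label≈ e′)))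
      where
      e′ : Edge A
      e′ = from edge↔ e

    source≡′ : ∀ i → source A i ≡ from vertex↔ (source B i)
    source≡′ i = trans (sym (strictlyInverseʳ vertex↔ (source A i))) (cong (from vertex↔) (sym (source≡ i)))

PresIso-trans : {R S T : LabelRel Σ} → (∀ {k} {x y z : Σ k} → S x y → R y z → T x z) →
                {A B C : Presentation Σ n} → PresIso R A B → PresIso S B C → PresIso T A C
PresIso-trans {Σ = Σ} {R = R} {S} {T} compose {A = A} {B} {C} I J = record
  { vertex↔ = ↔-trans I.vertex↔ J.vertex↔ ; edge↔ = ↔-trans I.edge↔ J.edge↔
  ; arity≡ = arity≡′ ; incidence≡ = incidence≡′ ; label≈ = label≈′ ; source≡ = source≡′ }
  where
  module I = PresIso I
  module J = PresIso J

  arity≡′ : ∀ e → arity C (to J.edge↔ (to I.edge↔ e)) ≡ arity A e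
  arity≡′ e = trans (J.arity≡ (to I.edge↔ e)) (I.arity≡ e)

  incidence≡′ : ∀ e i → incidence C (to J.edge↔ (to I.edge↔ e)) (cast (sym (arity≡′ e)) i)
                        ≡ to J.vertex↔ (to I.vertex↔ (incidence A e i))
  incidence≡′ e i = begin
    incidence C (to J.edge↔ e′) (cast (sym (arity≡′ e)) i)
      ≡˘⟨ cong (incidence C (to J.edge↔ e′)) (cast-trans (sym (I.arity≡ e)) (sym (J.arity≡ e′)) i) ⟩
    incidence C (to J.edge↔ e′) (cast (sym (J.arity≡ e′)) (cast (sym (I.arity≡ e)) i))
      ≡⟨ J.incidence≡ e′ _ ⟩
    to J.vertex↔ (incidence B e′ (cast (sym (I.arity≡ e)) i))
      ≡⟨ cong (to J.vertex↔) (I.incidence≡ e i) ⟩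
    to J.vertex↔ (to I.vertex↔ (incidence A e i))
      ∎
    where
    open ≡-Reasoning
    e′ : Edge B
    e′ = to I.edge↔ e

  label≈′ : ∀ e → T (subst Σ (arity≡′ e) (label C (to J.edge↔ (to I.edge↔ e)))) (label A e)
  label≈′ e = compose
    (subst (λ x → S x _) (subst-subst {P = Σ} (J.arity≡ (to I.edge↔ e)))
      (subst-preserves S (I.arity≡ e) (J.label≈ (to I.edge↔ e))))
    (I.label≈ e)

  source≡′ : ∀ i → source C i ≡ to J.vertex↔ (to I.vertex↔ (source A i))
  source≡′ i = trans (J.source≡ i) (cong (to J.vertex↔) (I.source≡ i))

PresIso-trans≡ : {A B C : Presentation Σ n} → PresIso _≡_ A B → PresIso _≡_ B C → PresIso _≡_ A C
PresIso-trans≡ = PresIso-trans trans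

Iso-refl : {R : LabelRel Σ} → (∀ {k} {x : Σ k} → R x x) → (G : Hyp Σ n) → Iso R G G
Iso-refl R-refl G = PresIso⇒Iso (PresIso-refl R-refl (present G))

Iso-sym : {R : LabelRel Σ} → (∀ {k} {x y : Σ k} → R x y → R y x) →
          {G G' : Hyp Σ n} → Iso R G G' → Iso R G' G
Iso-sym R-sym I = PresIso⇒Iso (PresIso-sym R-sym (Iso⇒PresIso I))

≈H-refl : {G : H Σ n} → G ≈H G
≈H-refl {G = G} = Iso-refl refl G

≈H-sym : {G G' : H Σ n} → G ≈H G' → G' ≈H G
≈H-sym = Iso-sym sym

-- Corresponding labels of isomorphic hypergraphs have arities that are only propositionally
-- equal; their sources are matched up along that equality.
present-cast : {m m' : ℕ} → m' ≡ m → Hyp Σ m' → Presentation Σ m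
present-cast p L = record
  { Vertex = Fin (V L) ; Edge = Fin (E L) ; arity = ar L
  ; incidence = inc L ; label = lab L ; source = λ i → src L (cast (sym p) i) }

Iso-subst⇒PresIso : {R : LabelRel Σ} {m m' : ℕ} (p : m' ≡ m) {L : Hyp Σ m} {L' : Hyp Σ m'} →
                    Iso R L (subst (H Σ) p L') → PresIso R (present L) (present-cast p L')
Iso-subst⇒PresIso refl {L' = L'} I = record
  { vertex↔ = vbij ; edge↔ = ebij ; arity≡ = ar≡ ; incidence≡ = inc≡ ; label≈ = lab≈
  ; source≡ = λ i → trans (cong (src L') (cast-is-id _ i)) (src≡ i) }
  where open Iso I

fromΣ-toΣ : ∀ E k x → fromΣ E k (toΣ E k x) ≡ x
fromΣ-toΣ (suc E) k x with splitAt (k zero) x | join-splitAt (k zero) (sumF E (λ e → k (suc e))) x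
... | inj₁ i | h = h
... | inj₂ j | h with toΣ E (λ e → k (suc e)) j | fromΣ-toΣ E (λ e → k (suc e)) j
...   | (e , f) | ih = trans (cong (k zero ↑ʳ_) ih) h

Σ↔sumF : ∀ E k → Sigma (Fin E) (λ e → Fin (k e)) ↔ Fin (sumF E k)
Σ↔sumF E k = mk↔ₛ′ (fromΣ E k) (toΣ E k) (fromΣ-toΣ E k) (toΣ-fromΣ E k)

IsSource : ∀ {m} (L : Hyp Σ m) → Fin (V L) → Set
IsSource L v = ∃ λ i → src L i ≡ v

-- The same functions as Flatten.isSrc? and Flatten.nsK, which ignore their module parameter:
-- InnerFlag L v is Fin (Flatten.nsK G L v) definitionally, and has an element iff v is not a source.
isSource? : ∀ {m} (L : Hyp Σ m) v → Dec (IsSource L v)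
isSource? L v = any? (λ i → src L i ≟ v)

InnerFlag : ∀ {m} (L : Hyp Σ m) → Fin (V L) → Set
InnerFlag L v = Fin (if does (isSource? L v) then 0 else 1)

Inner : ∀ {m} → Hyp Σ m → Set
Inner L = Sigma (Fin (V L)) (InnerFlag L)

module _ {m} (L : Hyp Σ m) {v : Fin (V L)} where

  inner-flag : ¬ IsSource L v → InnerFlag L v
  inner-flag ¬p with isSource? L v
  ... | yes p = ⊥-elim (¬p p)
  ... | no _  = zero

  inner-flag-absurd : IsSource L v → ¬ InnerFlag L v
  inner-flag-absurd p z with isSource? L v
  ... | no ¬p = ¬p p

  inner-flag-unique : (z z′ : InnerFlag L v) → z ≡ z′
  inner-flag-unique z z′ with isSource? L v
  inner-flag-unique zero zero | no _ = refl

Inner-≡ : ∀ {m} (L : Hyp Σ m) {v v′ : Fin (V L)} {z : InnerFlag L v} {z′ : InnerFlag L v′} →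
          v ≡ v′ → _≡_ {A = Inner L} (v , z) (v′ , z′)
Inner-≡ L {v} refl = cong (v ,_) (inner-flag-unique L _ _)

module FlattenProperties (G : Hyp (H Σ) n) where
  open Flatten G public

  inner≡ : ∀ {e v v′ z z′} → v ≡ v′ → _≡_ {A = NS} (e , v , z) (e , v′ , z′)
  inner≡ {e} eq = cong (e ,_) (Inner-≡ (lab G e) eq)

  data ParentView (e : Fin (E G)) (v : Fin (V (lab G e))) : Fin (V G) ⊎ NS → Set where
    is-source : ∀ i → src (lab G e) i ≡ v → ParentView e v (inj₁ (inc G e i))
    is-inner  : ∀ z → ¬ IsSource (lab G e) v → ParentView e v (inj₂ (e , v , z))

  parent-view : ∀ e v → ParentView e v (parent e v)
  parent-view e v = view (isSource? (lab G e) v) refl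
    where
    view : ∀ d eq → ParentView e v (parentAux e v d eq)
    view (yes (i , p)) _ = is-source i p
    view (no ¬p)       _ = is-inner _ ¬p

  encV↔ : (Fin (V G) ⊎ NS) ↔ Fin V'
  encV↔ = ↔-trans (↔-refl ⊎-↔ ↔-trans (Σ-↔ ↔-refl (Σ↔sumF _ _)) (Σ↔sumF _ _)) (↔-sym +↔⊎)

  decV : Fin V' → Fin (V G) ⊎ NS
  decV = from encV↔

  to-encV↔ : ∀ a → encV a ≡ to encV↔ a
  to-encV↔ (inj₁ _) = refl
  to-encV↔ (inj₂ _) = refl

  decV-encV : ∀ a → decV (encV a) ≡ a
  decV-encV a = trans (cong decV (to-encV↔ a)) (strictlyInverseʳ encV↔ a)

  encV-decV : ∀ u → encV (decV u) ≡ u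
  encV-decV u = trans (to-encV↔ (decV u)) (strictlyInverseˡ encV↔ u)

  source-of-flatten : ∀ {v} → IsSource (flatten G) (encV (inj₁ v)) → IsSource G v
  source-of-flatten (i , q) = i , inj₁-injective (encV-inj q)

  inner-not-source : ∀ {t} → ¬ IsSource (flatten G) (encV (inj₂ t))
  inner-not-source {t} (i , q) with encV-inj {inj₁ (src G i)} {inj₂ t} q
  ... | ()

  -- The sources of flatten G are those of G.
  Inner-flatten↔ : (Inner G ⊎ NS) ↔ Inner (flatten G)
  Inner-flatten↔ = mk↔ₛ′ encode decode encode-decode decode-encode
    where
    encode : Inner G ⊎ NS → Inner (flatten G)
    encode (inj₁ (v , z)) = encV (inj₁ v) , inner-flag (flatten G) (λ p → inner-flag-absurd G (source-of-flatten p) z)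
    encode (inj₂ t)       = encV (inj₂ t) , inner-flag (flatten G) inner-not-source

    decodeAt : ∀ u → InnerFlag (flatten G) u → (a : Fin (V G) ⊎ NS) → encV a ≡ u → Inner G ⊎ NS
    decodeAt u z (inj₁ v) eq = inj₁ (v , inner-flag G λ { (i , q) →
      inner-flag-absurd (flatten G) (i , trans (cong (encV ∘ inj₁) q) eq) z })
    decodeAt u z (inj₂ t) eq = inj₂ t

    decode : Inner (flatten G) → Inner G ⊎ NS
    decode (u , z) = decodeAt u z (decV u) (encV-decV u)

    encode-decodeAt : ∀ u z a eq → encode (decodeAt u z a eq) ≡ (u , z)
    encode-decodeAt u z (inj₁ _) eq = Inner-≡ (flatten G) eq
    encode-decodeAt u z (inj₂ _) eq = Inner-≡ (flatten G) eq

    encode-decode : ∀ x → encode (decode x) ≡ x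
    encode-decode (u , z) = encode-decodeAt u z (decV u) (encV-decV u)

    decodeAt-inj₁ : ∀ {v} (z : InnerFlag G v) {c a eq} → a ≡ inj₁ v → decodeAt (encV (inj₁ v)) c a eq ≡ inj₁ (v , z)
    decodeAt-inj₁ z refl = cong inj₁ (Inner-≡ G refl)

    decodeAt-inj₂ : ∀ t {c a eq} → a ≡ inj₂ t → decodeAt (encV (inj₂ t)) c a eq ≡ inj₂ t
    decodeAt-inj₂ t refl = refl

    decode-encode : ∀ x → decode (encode x) ≡ x
    decode-encode (inj₁ (v , z)) = decodeAt-inj₁ z (decV-encV (inj₁ v))
    decode-encode (inj₂ t)       = decodeAt-inj₂ t (decV-encV (inj₂ t))

  Edge² : Set
  Edge² = Sigma (Fin (E G)) (λ e → Fin (E (lab G e)))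

  flattenPres : Presentation Σ n
  flattenPres = record
    { Vertex = Fin (V G) ⊎ NS
    ; Edge = Edge²
    ; arity = λ p → ar (lab G (proj₁ p)) (proj₂ p)
    ; incidence = λ p i → parent (proj₁ p) (inc (lab G (proj₁ p)) (proj₂ p) i)
    ; label = λ p → lab (lab G (proj₁ p)) (proj₂ p)
    ; source = λ i → inj₁ (src G i) }

  flatten≅flattenPres : PresIso _≡_ (present (flatten G)) flattenPres
  flatten≅flattenPres = record
    { vertex↔ = ↔-sym encV↔ ; edge↔ = ↔-sym (Σ↔sumF _ _) ; arity≡ = λ _ → refl
    ; incidence≡ = λ x i → trans (cong (inc′ x) (cast-is-id _ i)) (sym (decV-encV _))
    ; label≈ = λ _ → refl
    ; source≡ = λ i → sym (decV-encV _) }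
    where
    inc′ : ∀ x → Fin (ar' x) → Fin (V G) ⊎ NS
    inc′ x j = parent (proj₁ (dec x)) (inc (lab G (proj₁ (dec x))) (proj₂ (dec x)) j)

Fin-cong↔ : {m m' : ℕ} → m ≡ m' → Fin m ↔ Fin m'
Fin-cong↔ refl = ↔-refl

module FlattenCong {R : LabelRel Σ} (R-sym : ∀ {k} {x y : Σ k} → R x y → R y x)
                   {G G' : Hyp (H Σ) n} (I : Iso (Iso R) G G') where
  module A = FlattenProperties G
  module B = FlattenProperties G'
  open Iso I using (vbij; ebij; ar≡; inc≡; src≡)

  label-iso : ∀ e → PresIso R (present (lab G e)) (present-cast (ar≡ e) (lab G' (to ebij e)))
  label-iso e = Iso-subst⇒PresIso (ar≡ e) (Iso-sym R-sym (Iso.lab≈ I e))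

  module LabelIso (e : Fin (E G)) where
    open PresIso (label-iso e) public

    L : Hyp Σ (ar G e)
    L = lab G e
    L' : Hyp Σ (ar G' (to ebij e))
    L' = lab G' (to ebij e)

    source-to : ∀ {v} → IsSource L v → IsSource L' (to vertex↔ v)
    source-to (i , q) = cast (sym (ar≡ e)) i , trans (source≡ i) (cong (to vertex↔) q)

    source-from : ∀ {v} → IsSource L' (to vertex↔ v) → IsSource L v
    source-from {v} (j , q) = cast (ar≡ e) j , Injection.injective (↔⇒↣ vertex↔) (begin
      to vertex↔ (src L (cast (ar≡ e) j))         ≡˘⟨ source≡ (cast (ar≡ e) j) ⟩
      src L' (cast (sym (ar≡ e)) (cast (ar≡ e) j)) ≡⟨ cong (src L') (cast-trans (ar≡ e) (sym (ar≡ e)) j) ⟩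
      src L' (cast refl j)                         ≡⟨ cong (src L') (cast-is-id refl j) ⟩
      src L' j                                     ≡⟨ q ⟩
      to vertex↔ v                                 ∎)
      where open ≡-Reasoning

    InnerFlag↔ : ∀ v → InnerFlag L v ↔ InnerFlag L' (to vertex↔ v)
    InnerFlag↔ v = Fin-cong↔ (cong (λ b → if b then 0 else 1)
      (does-≡ (isSource? L v) (map′ source-from source-to (isSource? L' (to vertex↔ v)))))

  inner↔ : A.NS ↔ B.NS
  inner↔ = Σ-↔ ebij λ {e} →
           Σ-↔ (LabelIso.vertex↔ e) λ {v} → LabelIso.InnerFlag↔ e v

  vertex↔ : (Fin (V G) ⊎ A.NS) ↔ (Fin (V G') ⊎ B.NS)
  vertex↔ = vbij ⊎-↔ inner↔

  parent-preserved : ∀ e v → B.parent (to ebij e) (to (LabelIso.vertex↔ e) v) ≡ to vertex↔ (A.parent e v)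
  parent-preserved e v
    with A.parent e v | A.parent-view e v
       | B.parent (to ebij e) (to (LabelIso.vertex↔ e) v) | B.parent-view (to ebij e) (to (LabelIso.vertex↔ e) v)
  ... | _ | A.is-source i q  | _ | B.is-source j q′ = cong inj₁ (trans (cong (inc G' (to ebij e)) j≡i) (inc≡ e i))
    where
    j≡i : j ≡ cast (sym (ar≡ e)) i
    j≡i = src-inj (lab G' (to ebij e)) (trans q′ (sym (proj₂ (LabelIso.source-to e (i , q)))))
  ... | _ | A.is-source i q  | _ | B.is-inner _ ¬q′  = ⊥-elim (¬q′ (LabelIso.source-to e (i , q)))
  ... | _ | A.is-inner _ ¬q  | _ | B.is-source j q′ = ⊥-elim (¬q (LabelIso.source-from e (j , q′)))
  ... | _ | A.is-inner _ _   | _ | B.is-inner _ _    = cong inj₂ (B.inner≡ refl)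

  flattenPres-cong : PresIso R A.flattenPres B.flattenPres
  flattenPres-cong = record
    { vertex↔ = vertex↔
    ; edge↔ = Σ-↔ ebij λ {e} → LabelIso.edge↔ e
    ; arity≡ = λ p → LabelIso.arity≡ (proj₁ p) (proj₂ p)
    ; incidence≡ = λ p i → trans (cong (B.parent (to ebij (proj₁ p))) (LabelIso.incidence≡ (proj₁ p) (proj₂ p) i))
                                 (parent-preserved (proj₁ p) _)
    ; label≈ = λ p → LabelIso.label≈ (proj₁ p) (proj₂ p)
    ; source≡ = λ i → cong inj₁ (src≡ i) }

flatten-cong : {R : LabelRel Σ} → (∀ {k} {x y : Σ k} → R x y → R y x) →
               {G G' : Hyp (H Σ) n} → Iso (Iso R) G G' → Iso R (flatten G) (flatten G')
flatten-cong {R = R} R-sym {G} {G'} I = PresIso⇒Iso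
  (PresIso-trans (λ r eq → subst (R _) eq r) (FlattenProperties.flatten≅flattenPres G)
    (PresIso-trans (λ eq r → subst (λ x → R x _) (sym eq) r) (FlattenCong.flattenPres-cong R-sym I)
      (PresIso-sym sym (FlattenProperties.flatten≅flattenPres G'))))

flattenPres≅⇒flatten≈H : (G : Hyp (H Σ) n) {G' : Hyp Σ n} →
               PresIso _≡_ (FlattenProperties.flattenPres G) (present G') → flatten G ≈H G'
flattenPres≅⇒flatten≈H G I = PresIso⇒Iso (PresIso-trans≡ (FlattenProperties.flatten≅flattenPres G) I)

module FlattenUnit (G : Hyp Σ n) where
  open FlattenProperties (unit {H Σ} G)

  vertex↔ : (Fin n ⊎ NS) ↔ Fin (V G)
  vertex↔ = mk↔ₛ′ to′ from′ (λ v → to′-classify v (isSource? G v)) from′-to′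
    where
    to′ : Fin n ⊎ NS → Fin (V G)
    to′ (inj₁ i)           = src G i
    to′ (inj₂ (_ , v , _)) = v

    classify : ∀ v → Dec (IsSource G v) → Fin n ⊎ NS
    classify v (yes (i , _)) = inj₁ i
    classify v (no ¬p)       = inj₂ (zero , v , inner-flag G ¬p)

    from′ : Fin (V G) → Fin n ⊎ NS
    from′ v = classify v (isSource? G v)

    to′-classify : ∀ v d → to′ (classify v d) ≡ v
    to′-classify v (yes (i , p)) = p
    to′-classify v (no _)        = refl

    classify-source : ∀ i d → classify (src G i) d ≡ inj₁ i
    classify-source i (yes (j , p)) = cong inj₁ (src-inj G p)
    classify-source i (no ¬p)       = ⊥-elim (¬p (i , refl))

    classify-inner : ∀ v z d → classify v d ≡ inj₂ (zero , v , z)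
    classify-inner v z (yes (i , p)) = ⊥-elim (inner-flag-absurd G (i , p) z)
    classify-inner v z (no _)        = cong inj₂ (inner≡ refl)

    from′-to′ : ∀ x → from′ (to′ x) ≡ x
    from′-to′ (inj₁ i)              = classify-source i (isSource? G (src G i))
    from′-to′ (inj₂ (zero , v , z)) = classify-inner v z (isSource? G v)

  parent-from : ∀ (e : Fin 1) v → v ≡ to vertex↔ (parent e v)
  parent-from e v with parent e v | parent-view e v
  ... | _ | is-source i q = sym q
  ... | _ | is-inner _ _  = refl

  flatten-unit : flatten (unit {H Σ} G) ≈H G
  flatten-unit = flattenPres≅⇒flatten≈H (unit G) (record
    { vertex↔ = vertex↔
    ; edge↔ = mk↔ₛ′ proj₂ (zero ,_) (λ _ → refl) (λ { (zero , _) → refl })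
    ; arity≡ = λ _ → refl
    ; incidence≡ = λ p i → trans (cong (inc G (proj₂ p)) (cast-is-id _ i)) (parent-from (proj₁ p) _)
    ; label≈ = λ _ → refl
    ; source≡ = λ _ → refl })

module FlattenMapUnit (G : Hyp Σ n) where
  open FlattenProperties (mapH unit G)

  no-inner : NS → ⊥
  no-inner (e , v , z) = inner-flag-absurd (unit {Σ} (lab G e)) (v , refl) z

  vertex↔ : (Fin (V G) ⊎ NS) ↔ Fin (V G)
  vertex↔ = mk↔ₛ′ [ id , ⊥-elim ∘ no-inner ]′ inj₁ (λ _ → refl) from-to
    where
    from-to : ∀ x → inj₁ ([ id , ⊥-elim ∘ no-inner ]′ x) ≡ x
    from-to (inj₁ _) = refl
    from-to (inj₂ x) = ⊥-elim (no-inner x)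

  parent-from : ∀ e i → inc G e i ≡ to vertex↔ (parent e i)
  parent-from e i with parent e i | parent-view e i
  ... | _ | is-source j q = cong (inc G e) (sym q)
  ... | _ | is-inner _ ¬q = ⊥-elim (¬q (i , refl))

  flatten-map-unit : flatten (mapH unit G) ≈H G
  flatten-map-unit = flattenPres≅⇒flatten≈H (mapH unit G) (record
    { vertex↔ = vertex↔
    ; edge↔ = mk↔ₛ′ proj₁ (_, zero) (λ _ → refl) (λ { (_ , zero) → refl })
    ; arity≡ = λ _ → refl
    ; incidence≡ = λ p i → trans (cong (inc G (proj₁ p)) (cast-is-id _ i)) (parent-from (proj₁ p) i)
    ; label≈ = λ _ → refl
    ; source≡ = λ _ → refl })

module FlattenAssoc (G : Hyp (H (H Σ)) n) where
  module A = FlattenProperties G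
  module P = FlattenProperties (flatten G)
  module Q = FlattenProperties (mapH flatten G)
  module D (e : Fin (E G)) = FlattenProperties (lab G e)
  open A using (Edge²)

  M : (p : Edge²) → Hyp Σ (ar (lab G (proj₁ p)) (proj₂ p))
  M p = lab (lab G (proj₁ p)) (proj₂ p)

  Vertex² : Set
  Vertex² = (Fin (V G) ⊎ A.NS) ⊎ Sigma Edge² (λ p → Inner (M p))

  classify² : (p : Edge²) (w : Fin (V (M p))) → Dec (IsSource (M p) w) → Vertex²
  classify² p w (yes (k , _)) = inj₁ (A.parent (proj₁ p) (inc (lab G (proj₁ p)) (proj₂ p) k))
  classify² p w (no ¬q)       = inj₂ (p , w , inner-flag (M p) ¬q)

  parent² : (p : Edge²) → Fin (V (M p)) → Vertex²
  parent² p w = classify² p w (isSource? (M p) w)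

  parent²-source : ∀ p w k → src (M p) k ≡ w →
                   parent² p w ≡ inj₁ (A.parent (proj₁ p) (inc (lab G (proj₁ p)) (proj₂ p) k))
  parent²-source p w k q = decided (isSource? (M p) w)
    where
    decided : ∀ d → classify² p w d ≡ inj₁ (A.parent (proj₁ p) (inc (lab G (proj₁ p)) (proj₂ p) k))
    decided (yes (k′ , q′)) = cong (λ j → inj₁ (A.parent (proj₁ p) (inc (lab G (proj₁ p)) (proj₂ p) j)))
                                  (src-inj (M p) (trans q′ (sym q)))
    decided (no ¬q)         = ⊥-elim (¬q (k , q))

  parent²-inner : ∀ p w (z : InnerFlag (M p) w) → ¬ IsSource (M p) w → parent² p w ≡ inj₂ (p , w , z)
  parent²-inner p w z ¬q = decided (isSource? (M p) w)
    where
    decided : ∀ d → classify² p w d ≡ inj₂ (p , w , z)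
    decided (yes q) = ⊥-elim (¬q q)
    decided (no _)  = cong (λ c → inj₂ (p , c)) (Inner-≡ (M p) refl)

  -- Both iterated flattenings are isomorphic to this one, which flattens two levels at once.
  flatten²Pres : Presentation Σ n
  flatten²Pres = record
    { Vertex = Vertex²
    ; Edge = Sigma Edge² (λ p → Fin (E (M p)))
    ; arity = λ y → ar (M (proj₁ y)) (proj₂ y)
    ; incidence = λ y i → parent² (proj₁ y) (inc (M (proj₁ y)) (proj₂ y) i)
    ; label = λ y → lab (M (proj₁ y)) (proj₂ y)
    ; source = λ i → inj₁ (inj₁ (src G i)) }

  vertexˡ↔ : (Fin (V (flatten G)) ⊎ P.NS) ↔ Vertex²
  vertexˡ↔ = ↔-sym A.encV↔ ⊎-↔ Σ-↔ (↔-sym (Σ↔sumF _ _)) ↔-refl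

  parent²-ˡ : ∀ x w → parent² (A.dec x) w ≡ to vertexˡ↔ (P.parent x w)
  parent²-ˡ x w with P.parent x w | P.parent-view x w
  ... | _ | P.is-source k q  = trans (parent²-source (A.dec x) w k q) (cong inj₁ (sym (A.decV-encV _)))
  ... | _ | P.is-inner z ¬q = parent²-inner (A.dec x) w z ¬q

  flatten∘flatten≅flatten² : PresIso _≡_ P.flattenPres flatten²Pres
  flatten∘flatten≅flatten² = record
    { vertex↔ = vertexˡ↔
    ; edge↔ = Σ-↔ (↔-sym (Σ↔sumF _ _)) ↔-refl
    ; arity≡ = λ _ → refl
    ; incidence≡ = λ y i → trans (cong (parent² (A.dec (proj₁ y)) ∘ inc (M (A.dec (proj₁ y))) (proj₂ y)) (cast-is-id _ i))
                                 (parent²-ˡ (proj₁ y) _)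
    ; label≈ = λ _ → refl
    ; source≡ = λ _ → cong inj₁ (sym (A.decV-encV _)) }

  vertexʳ↔ : Vertex² ↔ (Fin (V G) ⊎ Q.NS)
  vertexʳ↔ = mk↔ₛ′ to′ from′ to′-from′ from′-to′
    where
    to′ : Vertex² → Fin (V G) ⊎ Q.NS
    to′ (inj₁ (inj₁ v))           = inj₁ v
    to′ (inj₁ (inj₂ (e , x)))     = inj₂ (e , to (D.Inner-flatten↔ e) (inj₁ x))
    to′ (inj₂ ((e , f) , x))      = inj₂ (e , to (D.Inner-flatten↔ e) (inj₂ (f , x)))

    back : ∀ e → Inner (lab G e) ⊎ D.NS e → Vertex²
    back e (inj₁ x)       = inj₁ (inj₂ (e , x))
    back e (inj₂ (f , x)) = inj₂ ((e , f) , x)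

    from′ : Fin (V G) ⊎ Q.NS → Vertex²
    from′ (inj₁ v)       = inj₁ (inj₁ v)
    from′ (inj₂ (e , y)) = back e (from (D.Inner-flatten↔ e) y)

    to′-back : ∀ e s → to′ (back e s) ≡ inj₂ (e , to (D.Inner-flatten↔ e) s)
    to′-back e (inj₁ _) = refl
    to′-back e (inj₂ _) = refl

    to′-from′ : ∀ y → to′ (from′ y) ≡ y
    to′-from′ (inj₁ _)       = refl
    to′-from′ (inj₂ (e , y)) =
      trans (to′-back e _) (cong (λ y′ → inj₂ (e , y′)) (strictlyInverseˡ (D.Inner-flatten↔ e) y))

    from′-to′ : ∀ x → from′ (to′ x) ≡ x
    from′-to′ (inj₁ (inj₁ _))       = refl
    from′-to′ (inj₁ (inj₂ (e , x))) = cong (back e) (strictlyInverseʳ (D.Inner-flatten↔ e) (inj₁ x))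
    from′-to′ (inj₂ ((e , f) , x))  = cong (back e) (strictlyInverseʳ (D.Inner-flatten↔ e) (inj₂ (f , x)))

  parent²-ʳ-source : ∀ e v → Q.parent e (D.encV e (inj₁ v)) ≡ to vertexʳ↔ (inj₁ (A.parent e v))
  parent²-ʳ-source e v
    with A.parent e v | A.parent-view e v | Q.parent e (D.encV e (inj₁ v)) | Q.parent-view e (D.encV e (inj₁ v))
  ... | _ | A.is-source j q | _ | Q.is-source j′ q′ =
        cong (inj₁ ∘ inc G e) (src-inj (lab G e) (trans (inj₁-injective (D.encV-inj e q′)) (sym q)))
  ... | _ | A.is-source j q | _ | Q.is-inner _ ¬q′  = ⊥-elim (¬q′ (j , cong (D.encV e ∘ inj₁) q))
  ... | _ | A.is-inner _ ¬q | _ | Q.is-source j′ q′ = ⊥-elim (¬q (D.source-of-flatten e (j′ , q′)))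
  ... | _ | A.is-inner _ _  | _ | Q.is-inner _ _    = cong inj₂ (Q.inner≡ refl)

  parent²-ʳ : ∀ e f w → Q.parent e (D.encV e (D.parent e f w)) ≡ to vertexʳ↔ (parent² (e , f) w)
  parent²-ʳ e f w with D.parent e f w | D.parent-view e f w
  ... | _ | D.is-source k q =
        trans (parent²-ʳ-source e _) (cong (to vertexʳ↔) (sym (parent²-source (e , f) w k q)))
  ... | _ | D.is-inner z ¬q
      with Q.parent e (D.encV e (inj₂ (f , w , z))) | Q.parent-view e (D.encV e (inj₂ (f , w , z)))
  ...   | _ | Q.is-source j′ q′ = ⊥-elim (D.inner-not-source e (j′ , q′))
  ...   | _ | Q.is-inner _ _    =
        trans (cong inj₂ (Q.inner≡ refl)) (cong (to vertexʳ↔) (sym (parent²-inner (e , f) w z ¬q)))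

  flatten²≅flatten∘Hflatten : PresIso _≡_ flatten²Pres Q.flattenPres
  flatten²≅flatten∘Hflatten = record
    { vertex↔ = vertexʳ↔
    ; edge↔ = ↔-trans Σ-assoc-alt (Σ-↔ ↔-refl (Σ↔sumF _ _))
    ; arity≡ = λ { ((e , f) , g) → cong (arity-at e) (toΣ-fromΣ _ _ (f , g)) }
    ; incidence≡ = λ { ((e , f) , g) i →
        trans (dcong-cast (arity-at e) (incidence-at e) (toΣ-fromΣ _ _ (f , g)) _ i) (parent²-ʳ e f _) }
    ; label≈ = λ { ((e , f) , g) → dcong-subst {Σ = Σ} (arity-at e) (label-at e) (toΣ-fromΣ _ _ (f , g)) _ }
    ; source≡ = λ _ → refl }
    where
    arity-at : ∀ e → D.Edge² e → ℕ
    arity-at e s = ar (lab (lab G e) (proj₁ s)) (proj₂ s)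
    incidence-at : ∀ e s → Fin (arity-at e s) → Fin (V G) ⊎ Q.NS
    incidence-at e s j = Q.parent e (D.encV e (D.parent e (proj₁ s) (inc (lab (lab G e) (proj₁ s)) (proj₂ s) j)))
    label-at : ∀ e s → Σ (arity-at e s)
    label-at e s = lab (lab (lab G e) (proj₁ s)) (proj₂ s)

  flatten-assoc : flatten (flatten G) ≈H flatten (mapH flatten G)
  flatten-assoc = PresIso⇒Iso
    (PresIso-trans≡ (P.flatten≅flattenPres)
      (PresIso-trans≡ flatten∘flatten≅flatten²
        (PresIso-trans≡ flatten²≅flatten∘Hflatten (PresIso-sym sym Q.flatten≅flattenPres))))

mapH-cong : {R : LabelRel Σ} {S : LabelRel Γ} (f : Σ ⇒ Γ) → (∀ {k} {x y : Σ k} → R x y → S (f x) (f y)) →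
            {G G' : Hyp Σ n} → Iso R G G' → Iso S (mapH f G) (mapH f G')
mapH-cong {Σ = Σ} {S = S} f f-resp I = record
  { vbij = vbij ; ebij = ebij ; ar≡ = ar≡ ; inc≡ = inc≡ ; src≡ = src≡
  ; lab≈ = λ e → subst (λ x → S x _) (sym (subst-application′ Σ (λ _ → f) (ar≡ e))) (f-resp (lab≈ e)) }
  where open Iso I

unit-cong : {R : LabelRel Σ} {x y : Σ n} → R y x → Iso R (unit {Σ} x) (unit y)
unit-cong r = record
  { vbij = ↔-refl ; ebij = ↔-refl ; ar≡ = λ _ → refl ; inc≡ = λ _ i → cast-is-id _ i
  ; lab≈ = λ _ → r ; src≡ = λ _ → refl }

flatten-natural : (f : Σ ⇒ Γ) (G : H (H Σ) n) → flatten (mapH (mapH f) G) ≈H mapH f (flatten G)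
flatten-natural {Γ = Γ} {n = n} f G = PresIso⇒Iso (record
  { vertex↔ = ↔-refl ; edge↔ = ↔-refl ; arity≡ = λ _ → refl
  ; incidence≡ = λ x i → trans (cong (inc (flatten G) x) (cast-is-id _ i)) (parent-natural _ _ _ refl)
  ; label≈ = λ _ → refl ; source≡ = λ _ → refl })
  where
  G₁ : H (H Γ) n
  G₁ = mapH (mapH f) G
  parent-natural : ∀ e v d eq → Flatten.encV G (Flatten.parentAux G e v d eq)
                                ≡ Flatten.encV G₁ (Flatten.parentAux G₁ e v d eq)
  parent-natural e v (yes _) eq = refl
  parent-natural e v (no _)  eq = refl

fact3p5 : MonadLaws
fact3p5 = record
  { H-cong        = λ f → mapH-cong f (cong f)
  ; HH-cong       = λ f → mapH-cong (mapH f) (mapH-cong f (cong f))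
  ; unitH-cong    = λ I → unit-cong {R = _≈H_} (≈H-sym I)
  ; Hunit-cong    = mapH-cong unit (λ p → unit-cong {R = _≡_} (sym p))
  ; flatten-cong  = flatten-cong sym
  ; flattenH-cong = flatten-cong ≈H-sym
  ; Hflatten-cong = mapH-cong flatten (flatten-cong sym)
  ; H-id          = Iso-refl refl
  ; H-∘           = λ f g G → ≈H-refl
  ; unit-nat      = λ f a → ≈H-refl
  ; flatten-nat   = λ f → flatten-natural f
  ; assoc         = FlattenAssoc.flatten-assoc
  ; unit-left     = FlattenUnit.flatten-unit
  ; unit-right    = FlattenMapUnit.flatten-map-unit }
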